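{- For every $n\ge 1$ there are polynomials $P^{\mathbf r}_n,P^{\mathbf s}_n\in\mathbb{Q}[k]$ such that $A^{\mathbf r}_{n,k}=P^{\mathbf r}_n(k)$ and $A^{\mathbf s}_{n,k}=P^{\mathbf s}_n(k)$ for all integers $k\ge 2$, and $P^{\mathbf s}_n(k)=(-1)^nP^{\mathbf r}_n(-k)$.
   Context: For $k\ge 2$, $C_k\wr S_n$ is identified with the set of pairs $(\sigma,w)$, $\sigma\in S_n$, $w=w_1\cdots w_n\in\{0,\dots,k-1\}^n$. $A^{\mathbf r}_{n,k}$ is the number of $(\sigma,w)\in C_k\wr S_n$ for which there is no $i\le n-1$ with $\sigma_i<\sigma_{i+1}$ and $w_i\le w_{i+1}$; $A^{\mathbf s}_{n,k}$ is the number of $(\sigma,w)\in C_k\wr S_n$ for which there is no $i\le n-1$ with $\sigma_i<\sigma_{i+1}$ and $w_i< w_{i+1}$. -}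

module Defs where

open import Data.Bool using (Bool; true; false; not; _∧_; if_then_else_)
open import Data.Nat using (ℕ; zero; suc; _<ᵇ_; _≤ᵇ_)
open import Data.Fin using (Fin; toℕ)
open import Data.Fin.Properties using () renaming (_≟_ to _≟ᶠ_)
open import Data.List using (List; []; _∷_; [_]; map; concatMap; filterᵇ; length; allFin)
open import Data.Vec using (Vec; []; _∷_; toList)
open import Data.Product using (_×_; _,_; proj₁; proj₂)
open import Data.Rational using (ℚ; _+_; _*_; -_; 1ℚ; 0ℚ)
open import Relation.Nullary.Decidable using (⌊_⌋)
import Data.List.Relation.Unary.Unique.DecPropositional as UniqueDec

words : (k n : ℕ) → List (Vec (Fin k) n)
words k zero    = [ [] ]
words k (suc n) = concatMap (λ i → map (i ∷_) (words k n)) (allFin k)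

-- Permutations of [n] in one-line notation: words of length n over Fin n
-- with pairwise distinct letters (entry j ∈ Fin n stands for the value j+1).
isPerm : {n : ℕ} → Vec (Fin n) n → Bool
isPerm {n} σ = ⌊ UniqueDec.unique? (_≟ᶠ_ {n}) (toList σ) ⌋

perms : (n : ℕ) → List (Vec (Fin n) n)
perms n = filterᵇ isPerm (words n n)

-- The elements (σ , w) of C_k ≀ S_n.
wreath : (n k : ℕ) → List (Vec (Fin n) n × Vec (Fin k) n)
wreath n k = concatMap (λ σ → map (σ ,_) (words k n)) (perms n)

noBad : (ℕ → ℕ → Bool) → List ℕ → List ℕ → Bool
noBad R (s₁ ∷ s₂ ∷ ss) (w₁ ∷ w₂ ∷ ws) =
  not ((s₁ <ᵇ s₂) ∧ R w₁ w₂) ∧ noBad R (s₂ ∷ ss) (w₂ ∷ ws)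
noBad R _ _ = true

count : (ℕ → ℕ → Bool) → (n k : ℕ) → ℕ
count R n k = length (filterᵇ (λ p → noBad R (map toℕ (toList (proj₁ p))) (map toℕ (toList (proj₂ p)))) (wreath n k))

Ar : (n k : ℕ) → ℕ
Ar = count _≤ᵇ_

As : (n k : ℕ) → ℕ
As = count _<ᵇ_

-- Polynomials in ℚ[k] as coefficient lists (constant term first), and evaluation.
Poly : Set
Poly = List ℚ

eval : Poly → ℚ → ℚ
eval []       x = 0ℚ
eval (c ∷ cs) x = c + x * eval cs x

negOnePow : ℕ → ℚ
negOnePow zero    = 1ℚ
negOnePow (suc n) = - negOnePow n

ℕtoℚ : ℕ → ℚ
ℕtoℚ m = (Data.Integer.+ m) Data.Rational./ 1
  where import Data.Integer

module Submission where

-- Cut σ into its maximal ascending runs. The forbidden patterns only relate w_i and w_{i+1} inside a run, so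
-- the admissible words are chosen run by run: on a run of length m the letters must decrease strictly (A^r),
-- giving C(k, m) choices, or weakly (A^s), giving C(k + m - 1, m). Thus both counts are sums over σ of
-- products over its runs of k^(m falling)/m! and k^(m rising)/m!, polynomials in k; as
-- x^(m rising) = (-1)^m (-x)^(m falling) and the run lengths of σ add up to n, reciprocity follows.

open import Defs

module AscendingRuns where
  open import Data.Bool using (Bool; true; false; not; _∧_; if_then_else_; T?)
  open import Data.Nat
  open import Data.Nat.Properties
  open import Data.Nat.ListAction using (sum; product)
  open import Data.Nat.ListAction.Properties using (sum-++)
  open import Data.Nat.Combinatorics using (_C_; nC1≡n; nCk+nC[k+1]≡[n+1]C[k+1]; k>n⇒nCk≡0)
  open import Data.Fin using (Fin; toℕ)
  open import Data.List using (List; []; _∷_; [_]; map; applyUpTo; allFin; length; filterᵇ; concatMap; _++_; tabulate)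
  open import Data.List.Properties using (applyUpTo-∷ʳ; filter-++; length-++; length-map; map-cong; map-tabulate)
  import Data.List.NonEmpty as List⁺
  open List⁺ using (List⁺; _∷_; _∷⁺_)
  open import Data.Vec as Vec using (Vec)
  open import Data.Vec.Properties using (length-toList)
  open import Data.Product using (_,_)
  open import Function using (_∘_)
  open import Relation.Binary.PropositionalEquality using (_≡_; refl; sym; trans; cong; cong₂; module ≡-Reasoning)
  open ≡-Reasoning

  ∑< : ℕ → (ℕ → ℕ) → ℕ
  ∑< q f = sum (applyUpTo f q)

  infix 5 ∑<
  syntax ∑< q (λ p → e) = ∑[ p < q ] e

  ∑-suc : ∀ q (f : ℕ → ℕ) → ∑[ p < suc q ] f p ≡ (∑[ p < q ] f p) + f q
  ∑-suc q f = begin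
    sum (applyUpTo f (suc q))         ≡⟨ cong sum (applyUpTo-∷ʳ f q) ⟨
    sum (applyUpTo f q ++ [ f q ])    ≡⟨ sum-++ (applyUpTo f q) [ f q ] ⟩
    (∑[ p < q ] f p) + (f q + 0)      ≡⟨ cong ((∑[ p < q ] f p) +_) (+-identityʳ (f q)) ⟩
    (∑[ p < q ] f p) + f q            ∎

  ∑-cong : ∀ q {f g : ℕ → ℕ} → (∀ {p} → p < q → f p ≡ g p) → ∑[ p < q ] f p ≡ ∑[ p < q ] g p
  ∑-cong zero    eq = refl
  ∑-cong (suc q) eq = cong₂ _+_ (eq z<s) (∑-cong q (eq ∘ s<s))

  ∑-*ʳ : ∀ q (f : ℕ → ℕ) c → ∑[ p < q ] (f p * c) ≡ (∑[ p < q ] f p) * c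
  ∑-*ʳ zero    f c = refl
  ∑-*ʳ (suc q) f c = trans (cong (f 0 * c +_) (∑-*ʳ q (f ∘ suc) c)) (sym (*-distribʳ-+ c (f 0) _))

  ∑-const : ∀ q c → ∑[ p < q ] c ≡ q * c
  ∑-const zero    c = refl
  ∑-const (suc q) c = cong (c +_) (∑-const q c)

  ∑-truncate : ∀ (f : ℕ → ℕ) {r k} → r ≤ k → ∑[ j < k ] (if j <ᵇ r then f j else 0) ≡ ∑[ j < r ] f j
  ∑-truncate f {zero}  {zero}  _         = refl
  ∑-truncate f {zero}  {suc k} _         = ∑-truncate (f ∘ suc) {zero} {k} z≤n
  ∑-truncate f {suc r} {suc k} (s≤s r≤k) = cong (f 0 +_) (∑-truncate (f ∘ suc) r≤k)

  ∑-C-hockey-stick : ∀ c m q → c C suc m + (∑[ p < q ] (c + p) C m) ≡ (c + q) C suc m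
  ∑-C-hockey-stick c m zero    = trans (+-identityʳ _) (cong (_C suc m) (sym (+-identityʳ c)))
  ∑-C-hockey-stick c m (suc q) = begin
    c C suc m + (∑[ p < suc q ] (c + p) C m)    ≡⟨ cong (c C suc m +_) (∑-suc q (λ p → (c + p) C m)) ⟩
    c C suc m + ((∑[ p < q ] (c + p) C m) + (c + q) C m) ≡⟨ +-assoc (c C suc m) _ _ ⟨
    c C suc m + (∑[ p < q ] (c + p) C m) + (c + q) C m  ≡⟨ cong (_+ (c + q) C m) (∑-C-hockey-stick c m q) ⟩
    (c + q) C suc m + (c + q) C m               ≡⟨ +-comm ((c + q) C suc m) _ ⟩
    (c + q) C m + (c + q) C suc m               ≡⟨ nCk+nC[k+1]≡[n+1]C[k+1] (c + q) m ⟩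
    suc (c + q) C suc m                         ≡⟨ cong (_C suc m) (+-suc c q) ⟨
    (c + suc q) C suc m                         ∎

  private variable
    A B : Set

  countᵇ : (A → Bool) → List A → ℕ
  countᵇ P xs = length (filterᵇ P xs)

  countᵇ-++ : ∀ (P : A → Bool) xs ys → countᵇ P (xs ++ ys) ≡ countᵇ P xs + countᵇ P ys
  countᵇ-++ P xs ys = trans (cong length (filter-++ (T? ∘ P) xs ys)) (length-++ (filterᵇ P xs))

  countᵇ-concatMap : ∀ (P : B → Bool) (f : A → List B) xs →
                     countᵇ P (concatMap f xs) ≡ sum (map (countᵇ P ∘ f) xs)
  countᵇ-concatMap P f []       = refl
  countᵇ-concatMap P f (x ∷ xs) =
    trans (countᵇ-++ P (f x) (concatMap f xs)) (cong (countᵇ P (f x) +_) (countᵇ-concatMap P f xs))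

  countᵇ-map : ∀ (P : B → Bool) (g : A → B) xs → countᵇ P (map g xs) ≡ countᵇ (P ∘ g) xs
  countᵇ-map P g []       = refl
  countᵇ-map P g (x ∷ xs) with P (g x)
  ... | true  = cong suc (countᵇ-map P g xs)
  ... | false = countᵇ-map P g xs

  countᵇ-∧ : ∀ b (P : A → Bool) xs → countᵇ (λ x → b ∧ P x) xs ≡ (if b then countᵇ P xs else 0)
  countᵇ-∧ true  P xs       = refl
  countᵇ-∧ false P []       = refl
  countᵇ-∧ false P (x ∷ xs) = countᵇ-∧ false P xs

  letters : ∀ {k n} → Vec (Fin k) n → List ℕ
  letters w = map toℕ (Vec.toList w)

  length-letters : ∀ {k n} (w : Vec (Fin k) n) → length (letters w) ≡ n
  length-letters w = trans (length-map toℕ (Vec.toList w)) (length-toList w)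

  tabulate-∘-toℕ : ∀ (g : ℕ → A) n → tabulate {n = n} (g ∘ toℕ) ≡ applyUpTo g n
  tabulate-∘-toℕ g zero    = refl
  tabulate-∘-toℕ g (suc n) = cong (g 0 ∷_) (tabulate-∘-toℕ (g ∘ suc) n)

  countᵇ-words-suc : ∀ (P : List ℕ → Bool) k n →
    countᵇ (P ∘ letters) (words k (suc n)) ≡ ∑[ p < k ] countᵇ (λ v → P (p ∷ letters v)) (words k n)
  countᵇ-words-suc P k n = begin
    countᵇ (P ∘ letters) (concatMap (λ i → map (i Vec.∷_) (words k n)) (allFin k))
      ≡⟨ countᵇ-concatMap (P ∘ letters) (λ i → map (i Vec.∷_) (words k n)) (allFin k) ⟩
    sum (map (λ i → countᵇ (P ∘ letters) (map (i Vec.∷_) (words k n))) (allFin k))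
      ≡⟨ cong sum (map-cong (λ i → countᵇ-map (P ∘ letters) (i Vec.∷_) (words k n)) (allFin k)) ⟩
    sum (map (completions ∘ toℕ) (allFin k))
      ≡⟨ cong sum (trans (map-tabulate (λ i → i) (completions ∘ toℕ)) (tabulate-∘-toℕ completions k)) ⟩
    ∑[ p < k ] completions p ∎
    where
    completions : ℕ → ℕ
    completions p = countᵇ (λ v → P (p ∷ letters v)) (words k n)

  joinRun : Bool → List⁺ ℕ → List⁺ ℕ
  joinRun true  (m ∷ ms) = suc m ∷ ms
  joinRun false ms       = 1 ∷⁺ ms

  runs : ℕ → List ℕ → List⁺ ℕ
  runs a []      = 1 ∷ []
  runs a (b ∷ s) = joinRun (a <ᵇ b) (runs b s)

  runLengths : List ℕ → List ℕ
  runLengths []      = []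
  runLengths (a ∷ s) = List⁺.toList (runs a s)

  sum-joinRun : ∀ c r → sum (List⁺.toList (joinRun c r)) ≡ suc (sum (List⁺.toList r))
  sum-joinRun true  (m ∷ ms) = refl
  sum-joinRun false (m ∷ ms) = refl

  sum-runs : ∀ a s → sum (List⁺.toList (runs a s)) ≡ suc (length s)
  sum-runs a []      = refl
  sum-runs a (b ∷ s) = trans (sum-joinRun (a <ᵇ b) (runs b s)) (cong suc (sum-runs b s))

  sum-runLengths : ∀ s → sum (runLengths s) ≡ length s
  sum-runLengths []      = refl
  sum-runLengths (a ∷ s) = sum-runs a s

  module RunCounting
    (R : ℕ → ℕ → Bool) (bound : ℕ → ℕ) (H : ℕ → ℕ → ℕ)
    (¬R≡<bound : ∀ p j → not (R p j) ≡ (j <ᵇ bound p))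
    (bound≤suc : ∀ p → bound p ≤ suc p)
    (H-single : ∀ q → H q 1 ≡ q)
    (H-hockey-stick : ∀ q m → ∑[ p < q ] H (bound p) m ≡ H q (suc m))
    where
    -- Inside a run the letter after p must lie below bound p, and H q m counts the fillings x₁ … x_m of a
    -- run of length m with x₁ < q; weight k q gives the first run this bound q and every later run the bound k.

    weight : ℕ → ℕ → List⁺ ℕ → ℕ
    weight k q (m ∷ ms) = H q m * product (map (H k) ms)

    weight-ascent : ∀ k q r → ∑[ p < q ] weight k (bound p) r ≡ weight k q (joinRun true r)
    weight-ascent k q (m ∷ ms) = trans (∑-*ʳ q (λ p → H (bound p) m) _) (cong (_* _) (H-hockey-stick q m))

    weight-descent : ∀ k q r → ∑[ p < q ] weight k k r ≡ weight k q (joinRun false r)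
    weight-descent k q (m ∷ ms) = trans (∑-const q _) (cong (_* _) (sym (H-single q)))

    -- Summing over the first letter p < q, rather than fixing it, lets the induction close: the next letter
    -- ranges below bound p after an ascent and below k after a descent.
    ∑-first-letter : ∀ k a s {q} → q ≤ k →
      ∑[ p < q ] countᵇ (λ v → noBad R (a ∷ s) (p ∷ letters v)) (words k (length s)) ≡ weight k q (runs a s)
    ∑-first-letter k a []      {q} _   = trans (∑-const q 1) (sym (cong (_* 1) (H-single q)))
    ∑-first-letter k a (b ∷ s) {q} q≤k = begin
      ∑[ p < q ] countᵇ (λ v → noBad R (a ∷ b ∷ s) (p ∷ letters v)) (words k (suc (length s)))
        ≡⟨ ∑-cong q (λ {p} _ → countᵇ-words-suc (λ u → noBad R (a ∷ b ∷ s) (p ∷ u)) k (length s)) ⟩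
      ∑[ p < q ] ∑[ j < k ] countᵇ (λ v → not ((a <ᵇ b) ∧ R p j) ∧ Admissible j v) (words k (length s))
        ≡⟨ ascent-or-descent (a <ᵇ b) ⟩
      weight k q (joinRun (a <ᵇ b) (runs b s)) ∎
      where
      Admissible : ℕ → Vec (Fin k) (length s) → Bool
      Admissible j v = noBad R (b ∷ s) (j ∷ letters v)

      completions : ℕ → ℕ
      completions j = countᵇ (Admissible j) (words k (length s))

      below-bound : ∀ p → bound p ≤ k →
        ∑[ j < k ] countᵇ (λ v → not (R p j) ∧ Admissible j v) (words k (length s)) ≡ weight k (bound p) (runs b s)
      below-bound p bp≤k = begin
        ∑[ j < k ] countᵇ (λ v → not (R p j) ∧ Admissible j v) (words k (length s))
          ≡⟨ ∑-cong k (λ {j} _ → trans (countᵇ-∧ (not (R p j)) (Admissible j) (words k (length s)))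
                                       (cong (λ c → if c then completions j else 0) (¬R≡<bound p j))) ⟩
        ∑[ j < k ] (if j <ᵇ bound p then completions j else 0)  ≡⟨ ∑-truncate completions bp≤k ⟩
        ∑[ j < bound p ] completions j                          ≡⟨ ∑-first-letter k b s bp≤k ⟩
        weight k (bound p) (runs b s)                           ∎

      ascent-or-descent : ∀ asc →
        ∑[ p < q ] ∑[ j < k ] countᵇ (λ v → not (asc ∧ R p j) ∧ Admissible j v) (words k (length s))
          ≡ weight k q (joinRun asc (runs b s))
      ascent-or-descent true  = trans (∑-cong q (λ {p} p<q → below-bound p (≤-trans (bound≤suc p) (≤-trans p<q q≤k))))
                                      (weight-ascent k q (runs b s))
      ascent-or-descent false = trans (∑-cong q (λ _ → ∑-first-letter k b s ≤-refl)) (weight-descent k q (runs b s))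

    countᵇ-noBad : ∀ k s → countᵇ (noBad R s ∘ letters) (words k (length s)) ≡ product (map (H k) (runLengths s))
    countᵇ-noBad k []      = refl
    countᵇ-noBad k (a ∷ s) = trans (countᵇ-words-suc (noBad R (a ∷ s)) k (length s)) (∑-first-letter k a s ≤-refl)

    count≡∑∏ : ∀ n k → count R n k ≡ sum (map (λ σ → product (map (H k) (runLengths (letters σ)))) (perms n))
    count≡∑∏ n k = trans (countᵇ-concatMap _ (λ σ → map (σ ,_) (words k n)) (perms n))
                         (cong sum (map-cong per-permutation (perms n)))
      where
      per-permutation : ∀ σ → countᵇ _ (map (σ ,_) (words k n)) ≡ product (map (H k) (runLengths (letters σ)))
      per-permutation σ = begin
        countᵇ _ (map (σ ,_) (words k n))                          ≡⟨ countᵇ-map _ (σ ,_) (words k n) ⟩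
        countᵇ (noBad R (letters σ) ∘ letters) (words k n)          ≡⟨ cong (λ m → countᵇ (noBad R (letters σ) ∘ letters) (words k m)) (length-letters σ) ⟨
        countᵇ (noBad R (letters σ) ∘ letters) (words k (length (letters σ))) ≡⟨ countᵇ-noBad k (letters σ) ⟩
        product (map (H k) (runLengths (letters σ)))               ∎

  not-<ᵇ : ∀ p j → not (p <ᵇ j) ≡ (j <ᵇ suc p)
  not-<ᵇ p       zero    = refl
  not-<ᵇ zero    (suc j) = refl
  not-<ᵇ (suc p) (suc j) = not-<ᵇ p j

  not-≤ᵇ : ∀ p j → not (p ≤ᵇ j) ≡ (j <ᵇ p)
  not-≤ᵇ zero    j = refl
  not-≤ᵇ (suc p) j = not-<ᵇ p j

  -- C(k + m - 1, m), written without truncated subtraction.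
  _multichoose_ : ℕ → ℕ → ℕ
  k multichoose zero  = 1
  k multichoose suc t = (k + t) C suc t

  multichoose-1 : ∀ q → q multichoose 1 ≡ q
  multichoose-1 q = trans (cong (_C 1) (+-identityʳ q)) (nC1≡n q)

  ∑-multichoose-hockey-stick : ∀ q m → ∑[ p < q ] suc p multichoose m ≡ q multichoose suc m
  ∑-multichoose-hockey-stick q zero    = trans (∑-const q 1) (trans (*-identityʳ q) (sym (multichoose-1 q)))
  ∑-multichoose-hockey-stick q (suc t) = begin
    ∑[ p < q ] (suc p + t) C suc t                       ≡⟨ ∑-cong q (λ {p} _ → cong (λ i → suc i C suc t) (+-comm p t)) ⟩
    ∑[ p < q ] (suc t + p) C suc t                       ≡⟨ cong (_+ (∑[ p < q ] (suc t + p) C suc t)) (k>n⇒nCk≡0 (n<1+n (suc t))) ⟨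
    suc t C suc (suc t) + (∑[ p < q ] (suc t + p) C suc t) ≡⟨ ∑-C-hockey-stick (suc t) (suc t) q ⟩
    (suc t + q) C suc (suc t)                            ≡⟨ cong (_C suc (suc t)) (+-comm (suc t) q) ⟩
    (q + suc t) C suc (suc t)                            ∎

  Ar≡∑∏ : ∀ n k → Ar n k ≡ sum (map (λ σ → product (map (k C_) (runLengths (letters σ)))) (perms n))
  Ar≡∑∏ = RunCounting.count≡∑∏ _≤ᵇ_ (λ p → p) _C_ not-≤ᵇ n≤1+n nC1≡n (λ q m → ∑-C-hockey-stick 0 m q)

  As≡∑∏ : ∀ n k → As n k ≡ sum (map (λ σ → product (map (k multichoose_) (runLengths (letters σ)))) (perms n))
  As≡∑∏ = RunCounting.count≡∑∏ _<ᵇ_ suc _multichoose_ not-<ᵇ (λ _ → ≤-refl) multichoose-1 ∑-multichoose-hockey-stick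

module RunPolynomials where
  open AscendingRuns using (letters; length-letters; runLengths; sum-runLengths; _multichoose_; Ar≡∑∏; As≡∑∏)
  open import Data.Nat as ℕ using (ℕ; zero; suc; _!)
  import Data.Nat.Properties as ℕ
  open import Data.Nat.ListAction using (sum; product)
  open import Data.Nat.Combinatorics using (_C_; nCk+nC[k+1]≡[n+1]C[k+1])
  import Data.Nat.Coprimality as Coprime
  import Data.Integer as ℤ
  import Data.Integer.Properties as ℤ
  open import Data.Rational using (ℚ; mkℚ; 0ℚ; 1ℚ; _+_; _*_; -_; _-_; 1/_; NonZero)
  open import Data.Rational.Properties
  open import Data.Rational.Solver using (module +-*-Solver)
  open import Data.List using (List; []; _∷_; map; foldr)
  open import Data.List.Properties using (map-cong)
  open import Data.Product using (Σ; _,_)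
  open import Function using (_∘_)
  open import Relation.Binary.PropositionalEquality using (_≡_; refl; sym; trans; cong; cong₂; subst; module ≡-Reasoning)
  open ≡-Reasoning
  open +-*-Solver using (solve; _:+_; _:-_; _:*_; :-_; con; _:=_)

  private variable
    A : Set

  ℕtoℚ≡mkℚ : ∀ m → ℕtoℚ m ≡ mkℚ (ℤ.+ m) 0 (Coprime.sym (Coprime.1-coprimeTo m))
  ℕtoℚ≡mkℚ m = normalize-coprime (Coprime.sym (Coprime.1-coprimeTo m))

  ℕtoℚ-+ : ∀ a b → ℕtoℚ (a ℕ.+ b) ≡ ℕtoℚ a + ℕtoℚ b
  ℕtoℚ-+ a b = sym (trans (cong₂ _+_ (ℕtoℚ≡mkℚ a) (ℕtoℚ≡mkℚ b))
    (/-cong {p₁ = (ℤ.+ a ℤ.* ℤ.+ 1) ℤ.+ (ℤ.+ b ℤ.* ℤ.+ 1)} {p₂ = ℤ.+ a ℤ.+ ℤ.+ b}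
            (cong₂ ℤ._+_ (ℤ.*-identityʳ (ℤ.+ a)) (ℤ.*-identityʳ (ℤ.+ b))) refl))

  ℕtoℚ-* : ∀ a b → ℕtoℚ (a ℕ.* b) ≡ ℕtoℚ a * ℕtoℚ b
  ℕtoℚ-* a b = sym (trans (cong₂ _*_ (ℕtoℚ≡mkℚ a) (ℕtoℚ≡mkℚ b))
    (/-cong {p₁ = ℤ.+ a ℤ.* ℤ.+ b} {p₂ = ℤ.+ (a ℕ.* b)} (sym (ℤ.pos-* a b)) refl))

  ℕtoℚ-suc : ∀ a → ℕtoℚ (suc a) ≡ 1ℚ + ℕtoℚ a
  ℕtoℚ-suc = ℕtoℚ-+ 1

  ℕtoℚ-nonZero : ∀ n → .{{ℕ.NonZero n}} → NonZero (ℕtoℚ n)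
  ℕtoℚ-nonZero (suc n) = subst NonZero (sym (ℕtoℚ≡mkℚ (suc n))) _

  sumℚ : List ℚ → ℚ
  sumℚ = foldr _+_ 0ℚ

  productℚ : List ℚ → ℚ
  productℚ = foldr _*_ 1ℚ

  ℕtoℚ-sum : ∀ (f : A → ℕ) xs → ℕtoℚ (sum (map f xs)) ≡ sumℚ (map (ℕtoℚ ∘ f) xs)
  ℕtoℚ-sum f []       = refl
  ℕtoℚ-sum f (x ∷ xs) = trans (ℕtoℚ-+ (f x) _) (cong (ℕtoℚ (f x) +_) (ℕtoℚ-sum f xs))

  ℕtoℚ-product : ∀ (f : A → ℕ) xs → ℕtoℚ (product (map f xs)) ≡ productℚ (map (ℕtoℚ ∘ f) xs)
  ℕtoℚ-product f []       = refl
  ℕtoℚ-product f (x ∷ xs) = trans (ℕtoℚ-* (f x) _) (cong (ℕtoℚ (f x) *_) (ℕtoℚ-product f xs))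

  sumℚ-*ˡ : ∀ c (f : A → ℚ) xs → sumℚ (map (λ x → c * f x) xs) ≡ c * sumℚ (map f xs)
  sumℚ-*ˡ c f []       = sym (*-zeroʳ c)
  sumℚ-*ˡ c f (x ∷ xs) = trans (cong (c * f x +_) (sumℚ-*ˡ c f xs)) (sym (*-distribˡ-+ c (f x) _))

  negOnePow-+ : ∀ m n → negOnePow (m ℕ.+ n) ≡ negOnePow m * negOnePow n
  negOnePow-+ zero    n = sym (*-identityˡ (negOnePow n))
  negOnePow-+ (suc m) n = trans (cong -_ (negOnePow-+ m n)) (neg-distribˡ-* (negOnePow m) (negOnePow n))

  falling : ℕ → ℚ → ℚ
  falling zero    x = 1ℚ
  falling (suc m) x = falling m x * (x - ℕtoℚ m)

  rising : ℕ → ℚ → ℚ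
  rising zero    x = 1ℚ
  rising (suc m) x = rising m x * (x + ℕtoℚ m)

  falling-suc : ∀ m x → falling (suc m) x ≡ x * falling m (x - 1ℚ)
  falling-suc zero    x = solve 1 (λ x → con 1ℚ :* (x :- con 0ℚ) := x :* con 1ℚ) refl x
  falling-suc (suc m) x = begin
    falling (suc m) x * (x - ℕtoℚ (suc m))        ≡⟨ cong₂ (λ u v → u * (x - v)) (falling-suc m x) (ℕtoℚ-suc m) ⟩
    x * F * (x - (1ℚ + μ))                         ≡⟨ solve 3 (λ x F μ → x :* F :* (x :- (con 1ℚ :+ μ)) := x :* (F :* ((x :- con 1ℚ) :- μ))) refl x F μ ⟩
    x * (F * ((x - 1ℚ) - μ))                       ∎
    where
    F = falling m (x - 1ℚ)
    μ = ℕtoℚ m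

  falling-at-0 : ∀ m → falling (suc m) 0ℚ ≡ 0ℚ
  falling-at-0 m = trans (falling-suc m 0ℚ) (*-zeroˡ (falling m (0ℚ - 1ℚ)))

  falling-difference : ∀ m x → falling (suc m) (x + 1ℚ) ≡ falling (suc m) x + ℕtoℚ (suc m) * falling m x
  falling-difference m x = begin
    falling (suc m) (x + 1ℚ)                     ≡⟨ falling-suc m (x + 1ℚ) ⟩
    (x + 1ℚ) * falling m (x + 1ℚ - 1ℚ)            ≡⟨ cong (λ y → (x + 1ℚ) * falling m y) (solve 1 (λ x → x :+ con 1ℚ :- con 1ℚ := x) refl x) ⟩
    (x + 1ℚ) * F                                  ≡⟨ solve 3 (λ x F μ → (x :+ con 1ℚ) :* F := F :* (x :- μ) :+ (con 1ℚ :+ μ) :* F) refl x F μ ⟩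
    F * (x - μ) + (1ℚ + μ) * F                    ≡⟨ cong (λ c → F * (x - μ) + c * F) (ℕtoℚ-suc m) ⟨
    falling (suc m) x + ℕtoℚ (suc m) * F          ∎
    where
    F = falling m x
    μ = ℕtoℚ m

  rising≡falling : ∀ t x → rising (suc t) x ≡ falling (suc t) (x + ℕtoℚ t)
  rising≡falling zero    x = solve 1 (λ x → con 1ℚ :* (x :+ con 0ℚ) := con 1ℚ :* ((x :+ con 0ℚ) :- con 0ℚ)) refl x
  rising≡falling (suc t) x = begin
    rising (suc t) x * (x + ℕtoℚ (suc t))            ≡⟨ cong₂ (λ u v → u * (x + v)) (rising≡falling t x) (ℕtoℚ-suc t) ⟩
    falling (suc t) (x + τ) * (x + (1ℚ + τ))         ≡⟨ *-comm _ (x + (1ℚ + τ)) ⟩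
    (x + (1ℚ + τ)) * falling (suc t) (x + τ)         ≡⟨ cong (λ y → (x + (1ℚ + τ)) * falling (suc t) y) (solve 2 (λ x τ → x :+ τ := x :+ (con 1ℚ :+ τ) :- con 1ℚ) refl x τ) ⟩
    (x + (1ℚ + τ)) * falling (suc t) (x + (1ℚ + τ) - 1ℚ) ≡⟨ falling-suc (suc t) (x + (1ℚ + τ)) ⟨
    falling (suc (suc t)) (x + (1ℚ + τ))             ≡⟨ cong (λ y → falling (suc (suc t)) (x + y)) (ℕtoℚ-suc t) ⟨
    falling (suc (suc t)) (x + ℕtoℚ (suc t))         ∎
    where
    τ = ℕtoℚ t

  rising-reflection : ∀ m x → rising m x ≡ negOnePow m * falling m (- x)
  rising-reflection zero    x = refl
  rising-reflection (suc m) x = begin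
    rising m x * (x + μ)                  ≡⟨ cong (_* (x + μ)) (rising-reflection m x) ⟩
    s * F * (x + μ)                       ≡⟨ solve 4 (λ s F x μ → s :* F :* (x :+ μ) := (:- s) :* (F :* (:- x :- μ))) refl s F x μ ⟩
    (- s) * (F * (- x - μ))               ∎
    where
    s = negOnePow m
    F = falling m (- x)
    μ = ℕtoℚ m

  ℕtoℚ-C : ∀ k m → ℕtoℚ (k C m) * ℕtoℚ (m !) ≡ falling m (ℕtoℚ k)
  ℕtoℚ-C k       zero    = refl
  ℕtoℚ-C zero    (suc m) = trans (*-zeroˡ (ℕtoℚ (suc m !))) (sym (falling-at-0 m))
  ℕtoℚ-C (suc k) (suc m) = begin
    ℕtoℚ (suc k C suc m) * ℕtoℚ (suc m !)
      ≡⟨ cong₂ _*_ (trans (cong ℕtoℚ (sym (nCk+nC[k+1]≡[n+1]C[k+1] k m))) (ℕtoℚ-+ (k C m) (k C suc m))) (ℕtoℚ-* (suc m) (m !)) ⟩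
    (a + b) * (μ * f)
      ≡⟨ solve 4 (λ a b μ f → (a :+ b) :* (μ :* f) := b :* (μ :* f) :+ μ :* (a :* f)) refl a b μ f ⟩
    b * (μ * f) + μ * (a * f)
      ≡⟨ cong₂ (λ u v → u + μ * v) (trans (cong (b *_) (sym (ℕtoℚ-* (suc m) (m !)))) (ℕtoℚ-C k (suc m))) (ℕtoℚ-C k m) ⟩
    falling (suc m) (ℕtoℚ k) + μ * falling m (ℕtoℚ k)
      ≡⟨ falling-difference m (ℕtoℚ k) ⟨
    falling (suc m) (ℕtoℚ k + 1ℚ)
      ≡⟨ cong (falling (suc m)) (trans (+-comm (ℕtoℚ k) 1ℚ) (sym (ℕtoℚ-suc k))) ⟩
    falling (suc m) (ℕtoℚ (suc k)) ∎
    where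
    a = ℕtoℚ (k C m)
    b = ℕtoℚ (k C suc m)
    μ = ℕtoℚ (suc m)
    f = ℕtoℚ (m !)

  ℕtoℚ-multichoose : ∀ k m → ℕtoℚ (k multichoose m) * ℕtoℚ (m !) ≡ rising m (ℕtoℚ k)
  ℕtoℚ-multichoose k zero    = refl
  ℕtoℚ-multichoose k (suc t) = begin
    ℕtoℚ ((k ℕ.+ t) C suc t) * ℕtoℚ (suc t !)   ≡⟨ ℕtoℚ-C (k ℕ.+ t) (suc t) ⟩
    falling (suc t) (ℕtoℚ (k ℕ.+ t))             ≡⟨ cong (falling (suc t)) (ℕtoℚ-+ k t) ⟩
    falling (suc t) (ℕtoℚ k + ℕtoℚ t)            ≡⟨ rising≡falling t (ℕtoℚ k) ⟨
    rising (suc t) (ℕtoℚ k)                      ∎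

  1/factorial : ℕ → ℚ
  1/factorial m = (1/ ℕtoℚ (m !)) {{ℕtoℚ-nonZero (m !) {{m ℕ.!≢0}}}}

  factorial-cancel : ∀ {a b} m → a * ℕtoℚ (m !) ≡ b → b * 1/factorial m ≡ a
  factorial-cancel {a} {b} m eq = begin
    b * 1/factorial m                          ≡⟨ cong (_* 1/factorial m) eq ⟨
    a * ℕtoℚ (m !) * 1/factorial m             ≡⟨ *-assoc a _ _ ⟩
    a * (ℕtoℚ (m !) * 1/factorial m)           ≡⟨ cong (a *_) (*-inverseʳ (ℕtoℚ (m !)) {{ℕtoℚ-nonZero (m !) {{m ℕ.!≢0}}}}) ⟩
    a * 1ℚ                                     ≡⟨ *-identityʳ a ⟩
    a                                          ∎

  binomialℚ : ℕ → ℚ → ℚ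
  binomialℚ m x = falling m x * 1/factorial m

  multichooseℚ : ℕ → ℚ → ℚ
  multichooseℚ m x = rising m x * 1/factorial m

  binomialℚ-ℕ : ∀ k m → binomialℚ m (ℕtoℚ k) ≡ ℕtoℚ (k C m)
  binomialℚ-ℕ k m = factorial-cancel m (ℕtoℚ-C k m)

  multichooseℚ-ℕ : ∀ k m → multichooseℚ m (ℕtoℚ k) ≡ ℕtoℚ (k multichoose m)
  multichooseℚ-ℕ k m = factorial-cancel m (ℕtoℚ-multichoose k m)

  multichooseℚ-reflection : ∀ m x → multichooseℚ m x ≡ negOnePow m * binomialℚ m (- x)
  multichooseℚ-reflection m x =
    trans (cong (_* 1/factorial m) (rising-reflection m x)) (*-assoc (negOnePow m) _ _)

  infixl 6 _+ᴾ_
  infixl 7 _*ᴾ_ _·ᴾ_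

  _+ᴾ_ : Poly → Poly → Poly
  []      +ᴾ q       = q
  (a ∷ p) +ᴾ []      = a ∷ p
  (a ∷ p) +ᴾ (b ∷ q) = (a + b) ∷ (p +ᴾ q)

  _·ᴾ_ : ℚ → Poly → Poly
  c ·ᴾ p = map (c *_) p

  _*ᴾ_ : Poly → Poly → Poly
  []      *ᴾ q = []
  (a ∷ p) *ᴾ q = a ·ᴾ q +ᴾ (0ℚ ∷ p *ᴾ q)

  eval-+ᴾ : ∀ p q x → eval (p +ᴾ q) x ≡ eval p x + eval q x
  eval-+ᴾ []      q       x = sym (+-identityˡ _)
  eval-+ᴾ (a ∷ p) []      x = sym (+-identityʳ _)
  eval-+ᴾ (a ∷ p) (b ∷ q) x = begin
    (a + b) + x * eval (p +ᴾ q) x          ≡⟨ cong (λ e → (a + b) + x * e) (eval-+ᴾ p q x) ⟩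
    (a + b) + x * (eval p x + eval q x)    ≡⟨ solve 5 (λ a b x P Q → (a :+ b) :+ x :* (P :+ Q) := (a :+ x :* P) :+ (b :+ x :* Q)) refl a b x (eval p x) (eval q x) ⟩
    (a + x * eval p x) + (b + x * eval q x) ∎

  eval-·ᴾ : ∀ c p x → eval (c ·ᴾ p) x ≡ c * eval p x
  eval-·ᴾ c []      x = sym (*-zeroʳ c)
  eval-·ᴾ c (a ∷ p) x = begin
    c * a + x * eval (c ·ᴾ p) x     ≡⟨ cong (λ e → c * a + x * e) (eval-·ᴾ c p x) ⟩
    c * a + x * (c * eval p x)      ≡⟨ solve 4 (λ c a x P → c :* a :+ x :* (c :* P) := c :* (a :+ x :* P)) refl c a x (eval p x) ⟩
    c * (a + x * eval p x)          ∎

  eval-*ᴾ : ∀ p q x → eval (p *ᴾ q) x ≡ eval p x * eval q x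
  eval-*ᴾ []      q x = sym (*-zeroˡ (eval q x))
  eval-*ᴾ (a ∷ p) q x = begin
    eval (a ·ᴾ q +ᴾ (0ℚ ∷ p *ᴾ q)) x              ≡⟨ eval-+ᴾ (a ·ᴾ q) (0ℚ ∷ p *ᴾ q) x ⟩
    eval (a ·ᴾ q) x + (0ℚ + x * eval (p *ᴾ q) x)  ≡⟨ cong₂ (λ u v → u + (0ℚ + x * v)) (eval-·ᴾ a q x) (eval-*ᴾ p q x) ⟩
    a * Q + (0ℚ + x * (P * Q))                    ≡⟨ solve 4 (λ a x P Q → a :* Q :+ (con 0ℚ :+ x :* (P :* Q)) := (a :+ x :* P) :* Q) refl a x P Q ⟩
    (a + x * P) * Q                               ∎
    where
    P = eval p x
    Q = eval q x

  IsPolynomial : (ℚ → ℚ) → Set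
  IsPolynomial f = Σ Poly λ P → ∀ x → eval P x ≡ f x

  const-polynomial : ∀ c → IsPolynomial (λ _ → c)
  const-polynomial c = c ∷ [] , λ x → trans (cong (c +_) (*-zeroʳ x)) (+-identityʳ c)

  id-polynomial : IsPolynomial (λ x → x)
  id-polynomial = 0ℚ ∷ 1ℚ ∷ [] , λ x → solve 1 (λ x → con 0ℚ :+ x :* (con 1ℚ :+ x :* con 0ℚ) := x) refl x

  +-polynomial : ∀ {f g} → IsPolynomial f → IsPolynomial g → IsPolynomial (λ x → f x + g x)
  +-polynomial (P , P≡f) (Q , Q≡g) = P +ᴾ Q , λ x → trans (eval-+ᴾ P Q x) (cong₂ _+_ (P≡f x) (Q≡g x))

  *-polynomial : ∀ {f g} → IsPolynomial f → IsPolynomial g → IsPolynomial (λ x → f x * g x)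
  *-polynomial (P , P≡f) (Q , Q≡g) = P *ᴾ Q , λ x → trans (eval-*ᴾ P Q x) (cong₂ _*_ (P≡f x) (Q≡g x))

  sumℚ-polynomial : ∀ {f : A → ℚ → ℚ} xs → (∀ a → IsPolynomial (f a)) → IsPolynomial (λ x → sumℚ (map (λ a → f a x) xs))
  sumℚ-polynomial []       _  = const-polynomial 0ℚ
  sumℚ-polynomial (a ∷ xs) fP = +-polynomial (fP a) (sumℚ-polynomial xs fP)

  productℚ-polynomial : ∀ {f : A → ℚ → ℚ} xs → (∀ a → IsPolynomial (f a)) → IsPolynomial (λ x → productℚ (map (λ a → f a x) xs))
  productℚ-polynomial []       _  = const-polynomial 1ℚ
  productℚ-polynomial (a ∷ xs) fP = *-polynomial (fP a) (productℚ-polynomial xs fP)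

  falling-polynomial : ∀ m → IsPolynomial (falling m)
  falling-polynomial zero    = const-polynomial 1ℚ
  falling-polynomial (suc m) = *-polynomial (falling-polynomial m) (+-polynomial id-polynomial (const-polynomial (- ℕtoℚ m)))

  rising-polynomial : ∀ m → IsPolynomial (rising m)
  rising-polynomial zero    = const-polynomial 1ℚ
  rising-polynomial (suc m) = *-polynomial (rising-polynomial m) (+-polynomial id-polynomial (const-polynomial (ℕtoℚ m)))

  binomialℚ-polynomial : ∀ m → IsPolynomial (binomialℚ m)
  binomialℚ-polynomial m = *-polynomial (falling-polynomial m) (const-polynomial (1/factorial m))

  multichooseℚ-polynomial : ∀ m → IsPolynomial (multichooseℚ m)
  multichooseℚ-polynomial m = *-polynomial (rising-polynomial m) (const-polynomial (1/factorial m))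

  runSum : (ℕ → ℚ → ℚ) → ℕ → ℚ → ℚ
  runSum φ n x = sumℚ (map (λ σ → productℚ (map (λ m → φ m x) (runLengths (letters σ)))) (perms n))

  runSum-polynomial : ∀ {φ} → (∀ m → IsPolynomial (φ m)) → ∀ n → IsPolynomial (runSum φ n)
  runSum-polynomial φP n = sumℚ-polynomial (perms n) (λ σ → productℚ-polynomial (runLengths (letters σ)) φP)

  runSum-ℕ : ∀ φ (H : ℕ → ℕ → ℕ) k → (∀ m → φ m (ℕtoℚ k) ≡ ℕtoℚ (H k m)) → ∀ n →
    runSum φ n (ℕtoℚ k) ≡ ℕtoℚ (sum (map (λ σ → product (map (H k) (runLengths (letters σ)))) (perms n)))
  runSum-ℕ φ H k φ≡H n = sym (begin
    ℕtoℚ (sum (map (λ σ → product (map (H k) (lengths σ))) (perms n)))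
      ≡⟨ ℕtoℚ-sum (λ σ → product (map (H k) (lengths σ))) (perms n) ⟩
    sumℚ (map (λ σ → ℕtoℚ (product (map (H k) (lengths σ)))) (perms n))
      ≡⟨ cong sumℚ (map-cong (λ σ → trans (ℕtoℚ-product (H k) (lengths σ)) (cong productℚ (map-cong (sym ∘ φ≡H) (lengths σ)))) (perms n)) ⟩
    runSum φ n (ℕtoℚ k) ∎)
    where
    lengths = λ σ → runLengths (letters σ)

  productℚ-reflection : ∀ {φ ψ : ℕ → ℚ → ℚ} → (∀ m x → ψ m x ≡ negOnePow m * φ m (- x)) → ∀ ms x →
    productℚ (map (λ m → ψ m x) ms) ≡ negOnePow (sum ms) * productℚ (map (λ m → φ m (- x)) ms)
  productℚ-reflection ψ≡φ []       x = refl
  productℚ-reflection {φ} {ψ} ψ≡φ (m ∷ ms) x = begin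
    ψ m x * productℚ (map (λ m → ψ m x) ms)
      ≡⟨ cong₂ _*_ (ψ≡φ m x) (productℚ-reflection {φ} {ψ} ψ≡φ ms x) ⟩
    negOnePow m * φ m (- x) * (negOnePow (sum ms) * Φ)
      ≡⟨ solve 4 (λ s φ t Φ → s :* φ :* (t :* Φ) := s :* t :* (φ :* Φ)) refl (negOnePow m) (φ m (- x)) (negOnePow (sum ms)) Φ ⟩
    negOnePow m * negOnePow (sum ms) * (φ m (- x) * Φ)
      ≡⟨ cong (_* (φ m (- x) * Φ)) (negOnePow-+ m (sum ms)) ⟨
    negOnePow (m ℕ.+ sum ms) * (φ m (- x) * Φ) ∎
    where
    Φ = productℚ (map (λ m → φ m (- x)) ms)

  runSum-reflection : ∀ {φ ψ : ℕ → ℚ → ℚ} → (∀ m x → ψ m x ≡ negOnePow m * φ m (- x)) → ∀ n x →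
    runSum ψ n x ≡ negOnePow n * runSum φ n (- x)
  runSum-reflection {φ} {ψ} ψ≡φ n x = begin
    runSum ψ n x
      ≡⟨ cong sumℚ (map-cong (λ σ → trans (productℚ-reflection {φ} {ψ} ψ≡φ (lengths σ) x) (cong (λ l → negOnePow l * Φ σ) (trans (sum-runLengths (letters σ)) (length-letters σ)))) (perms n)) ⟩
    sumℚ (map (λ σ → negOnePow n * Φ σ) (perms n))
      ≡⟨ sumℚ-*ˡ (negOnePow n) Φ (perms n) ⟩
    negOnePow n * runSum φ n (- x) ∎
    where
    lengths = λ σ → runLengths (letters σ)
    Φ = λ σ → productℚ (map (λ m → φ m (- x)) (lengths σ))

  runSum-binomialℚ≡Ar : ∀ n k → runSum binomialℚ n (ℕtoℚ k) ≡ ℕtoℚ (Ar n k)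
  runSum-binomialℚ≡Ar n k = trans (runSum-ℕ binomialℚ _C_ k (binomialℚ-ℕ k) n) (cong ℕtoℚ (sym (Ar≡∑∏ n k)))

  runSum-multichooseℚ≡As : ∀ n k → runSum multichooseℚ n (ℕtoℚ k) ≡ ℕtoℚ (As n k)
  runSum-multichooseℚ≡As n k = trans (runSum-ℕ multichooseℚ _multichoose_ k (multichooseℚ-ℕ k) n) (cong ℕtoℚ (sym (As≡∑∏ n k)))

open import Data.Nat using (ℕ; _≤_)
open import Data.Product using (Σ; _×_; _,_)
open import Data.Rational using (ℚ; _*_; -_)
open import Relation.Binary.PropositionalEquality using (_≡_; trans; cong; module ≡-Reasoning)
open RunPolynomials

mainTheorem16 : (n : ℕ) → 1 ≤ n →
    Σ Poly (λ Pr → Σ Poly (λ Ps →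
    ((k : ℕ) → 2 ≤ k → eval Pr (ℕtoℚ k) ≡ ℕtoℚ (Ar n k))
    × ((k : ℕ) → 2 ≤ k → eval Ps (ℕtoℚ k) ≡ ℕtoℚ (As n k))
    × ((x : ℚ) → eval Ps x ≡ negOnePow n * eval Pr (- x))))
mainTheorem16 n _ =
  Pr , Ps
  , (λ k _ → trans (Pr≡ (ℕtoℚ k)) (runSum-binomialℚ≡Ar n k))
  , (λ k _ → trans (Ps≡ (ℕtoℚ k)) (runSum-multichooseℚ≡As n k))
  , λ x → begin
      eval Ps x                                ≡⟨ Ps≡ x ⟩
      runSum multichooseℚ n x                  ≡⟨ runSum-reflection {binomialℚ} {multichooseℚ} multichooseℚ-reflection n x ⟩
      negOnePow n * runSum binomialℚ n (- x)   ≡⟨ cong (negOnePow n *_) (Pr≡ (- x)) ⟨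
      negOnePow n * eval Pr (- x)              ∎
  where
  open ≡-Reasoning
  open Σ (runSum-polynomial binomialℚ-polynomial n) renaming (proj₁ to Pr; proj₂ to Pr≡)
  open Σ (runSum-polynomial multichooseℚ-polynomial n) renaming (proj₁ to Ps; proj₂ to Ps≡)
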